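{- Let $\mathbb{F}$ be a finite field of order $q$ with $\mathrm{char}(\mathbb{F})\neq 2$, and let $C_1,C_2\in M^{2\times 2}(\mathbb{F})$. The two-dimensional subspaces $g_1=\left[\begin{array}{c} I\\ C_1\end{array}\right]$ and $g_2=\left[\begin{array}{c} I\\ C_2\end{array}\right]$ of $\mathbb{F}^4$ generate orthogonal linear sudoku squares of parallel type if and only if each of $C_1,C_2$ is invertible and not lower triangular (i.e. has nonzero upper-right entry), and $\det(C_1-C_2)\neq 0$.
   Context: For $A,B\in M^{2\times 2}(\mathbb{F})$, $\left[\begin{array}{c} A\\ B\end{array}\right]$ denotes the subspace of $\mathbb{F}^4$ spanned by the columns of the $4\times 2$ matrix $\begin{pmatrix} A\\ B\end{pmatrix}$; $I$ is the $2\times 2$ identity matrix. A sudoku square of order $n^2$ is a latin square of order $n^2$ such that, when the array is partitioned into $n\times n$ subsquares in the natural way, each subsquare contains every symbol. Locations of an array of order $q^2$ are identified with vectors $(x_1,x_2,x_3,x_4)\in\mathbb{F}^4$: $x_1$ is the large row (which horizontal band of $q$ subsquares), $x_2$ the mini row (row within the band), $x_3$ the large column, $x_4$ the mini column; so the row of a location is determined by $(x_1,x_2)$, its column by $(x_3,x_4)$, and its subsquare by $(x_1,x_3)$. For a two-dimensional subspace $g\subseteq\mathbb{F}^4$, the array $M_g$ assigns to the locations in each coset $x+g$ a common symbol, distinct cosets receiving distinct symbols. We say $g$ generates a linear sudoku square of parallel type if $M_g$ is a sudoku square. Two squares of the same order are orthogonal if, upon superimposition, each ordered pair of symbols occurs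 in exactly one location. -}

module Defs where

open import Level using (Level; _⊔_) renaming (suc to lsuc)
open import Algebra.Bundles using (CommutativeRing)
open import Data.Nat using (ℕ)
open import Data.Fin using (Fin; zero; suc)
open import Data.Product using (Σ; ∃; ∃-syntax; _×_; _,_)
open import Function.Bundles using (Inverse)
open import Relation.Nullary using (¬_)
import Relation.Binary.PropositionalEquality as ≡

record FiniteField (c ℓ : Level) : Set (lsuc (c ⊔ ℓ)) where
  field
    commRing : CommutativeRing c ℓ
  open CommutativeRing commRing public
  field
    1≉0     : ¬ (1# ≈ 0#)
    inverse : ∀ x → ¬ (x ≈ 0#) → ∃[ y ] (x * y ≈ 1#)
    order   : ℕ
    finite  : Inverse setoid (≡.setoid (Fin order))

module Sudoku {c ℓ : Level} (F : FiniteField c ℓ) where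
  open FiniteField F hiding (zero)

  -- vectors of F^4 and 2×2 / 4×2 matrices; M i j = entry in row i, column j
  Vec4 : Set c
  Vec4 = Fin 4 → Carrier

  Mat2 : Set c
  Mat2 = Fin 2 → Fin 2 → Carrier

  Mat42 : Set c
  Mat42 = Fin 4 → Fin 2 → Carrier

  I₂ : Mat2
  I₂ zero    zero    = 1#
  I₂ zero    (suc _) = 0#
  I₂ (suc _) zero    = 0#
  I₂ (suc _) (suc _) = 1#

  _·_ : Mat2 → Mat2 → Mat2
  (A · B) i j = A i zero * B zero j + A i (suc zero) * B (suc zero) j

  _−_ : Mat2 → Mat2 → Mat2
  (A − B) i j = A i j - B i j

  _≈M_ : Mat2 → Mat2 → Set ℓ
  A ≈M B = ∀ i j → A i j ≈ B i j

  det : Mat2 → Carrier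
  det A = A zero zero * A (suc zero) (suc zero) - A zero (suc zero) * A (suc zero) zero

  Invertible : Mat2 → Set (c ⊔ ℓ)
  Invertible A = ∃[ B ] ((A · B) ≈M I₂ × (B · A) ≈M I₂)

  stack : Mat2 → Mat2 → Mat42
  stack A B zero                   = A zero
  stack A B (suc zero)             = A (suc zero)
  stack A B (suc (suc zero))       = B zero
  stack A B (suc (suc (suc zero))) = B (suc zero)

  Subspace : Set (lsuc (c ⊔ ℓ))
  Subspace = Vec4 → Set (c ⊔ ℓ)

  colSpan : Mat42 → Subspace
  colSpan M v = ∃[ a ] ∃[ b ] (∀ i → v i ≈ M i zero * a + M i (suc zero) * b)

  ⟦_⨾_⟧ : Mat2 → Mat2 → Subspace
  ⟦ A ⨾ B ⟧ = colSpan (stack A B)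

  _-v_ : Vec4 → Vec4 → Vec4
  (x -v y) i = x i - y i

  _≈v_ : Vec4 → Vec4 → Set ℓ
  x ≈v y = ∀ i → x i ≈ y i

  -- location with large row x1, mini row x2, large column x3, mini column x4
  loc : Carrier → Carrier → Carrier → Carrier → Vec4
  loc x1 x2 x3 x4 zero                   = x1
  loc x1 x2 x3 x4 (suc zero)             = x2
  loc x1 x2 x3 x4 (suc (suc zero))       = x3
  loc x1 x2 x3 x4 (suc (suc (suc zero))) = x4

  -- In M_g, location z carries the symbol of the coset z + g; so location z
  -- carries the symbol of the coset x + g iff z - x ∈ g.
  HasSymbol : Subspace → Vec4 → Vec4 → Set (c ⊔ ℓ)
  HasSymbol g x z = g (z -v x)

  ExactlyOnePair : (Carrier → Carrier → Set (c ⊔ ℓ)) → Set (c ⊔ ℓ)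
  ExactlyOnePair P =
    Σ (Carrier × Carrier) λ { (u , v) →
      P u v × (∀ u' v' → P u' v' → (u' ≈ u) × (v' ≈ v)) }

  LatinRows : Subspace → Set (c ⊔ ℓ)
  LatinRows g = ∀ (x : Vec4) x1 x2 →
    ExactlyOnePair λ x3 x4 → HasSymbol g x (loc x1 x2 x3 x4)

  LatinCols : Subspace → Set (c ⊔ ℓ)
  LatinCols g = ∀ (x : Vec4) x3 x4 →
    ExactlyOnePair λ x1 x2 → HasSymbol g x (loc x1 x2 x3 x4)

  Subsquares : Subspace → Set (c ⊔ ℓ)
  Subsquares g = ∀ (x : Vec4) x1 x3 →
    ∃[ x2 ] ∃[ x4 ] HasSymbol g x (loc x1 x2 x3 x4)

  GeneratesSudoku : Subspace → Set (c ⊔ ℓ)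
  GeneratesSudoku g = LatinRows g × LatinCols g × Subsquares g

  Orthogonal : Subspace → Subspace → Set (c ⊔ ℓ)
  Orthogonal g h = ∀ (x y : Vec4) →
    Σ Vec4 λ z → (HasSymbol g x z × HasSymbol h y z) ×
      (∀ z' → HasSymbol g x z' × HasSymbol h y z' → z' ≈v z)

  GenerateOrthogonalSudoku : Subspace → Subspace → Set (c ⊔ ℓ)
  GenerateOrthogonalSudoku g h =
    GeneratesSudoku g × GeneratesSudoku h × Orthogonal g h

-- Membership in g = [I ; C] says that the bottom half of a vector is C applied to its top
-- half, so in M_g the symbol of x + g occupies exactly the graph of the affine map
-- s ↦ C s + (bottom x − C top x), where the top half of a location is its row and the bottom
-- half its column.  Hence rows are always latin; columns are latin iff s ↦ C s is bijective,
-- i.e. det C ≠ 0, i.e. C is invertible; a subsquare prescribes x1 and x3 and leaves x4 free,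
-- so it meets every graph iff x3 = C₀₀ x1 + C₀₁ x2 + const is solvable in x2, i.e. C₀₁ ≠ 0; and
-- the graphs of the two squares meet in exactly one location iff (C₁ − C₂) s = o₂ − o₁ has a
-- unique solution for all intercepts o₁, o₂, i.e. det (C₁ − C₂) ≠ 0.
module Submission where

open import Defs
open import Level using (Level; _⊔_)
open import Data.Fin using (zero; suc)
open import Data.Product using (_×_; _,_; proj₁; proj₂)
open import Relation.Nullary using (¬_)
open import Function.Bundles using (_⇔_; mk⇔; Equivalence)
open import Function.Properties.Equivalence using () renaming (trans to ⇔-trans)
open import Data.Product.Function.NonDependent.Propositional using (_×-⇔_)
open import Algebra.Bundles using (CommutativeRing)
import Data.Integer as ℤ
import Relation.Binary.Reasoning.Setoid

-- The ring solver needs coefficients with decidable equality mapping into the ring;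
-- ℤ maps into every commutative ring.
module IntegerCoefficients {c ℓ : Level} (R : CommutativeRing c ℓ) where
  open CommutativeRing R
  open import Data.Nat as ℕ using (zero; suc)
  import Data.Nat.Properties as ℕ
  open import Data.Integer using (ℤ; +_; -[1+_]; _⊖_; _◃_; sign; ∣_∣)
  import Data.Integer.Properties as ℤ
  open import Data.Sign as Sign using (Sign)
  open import Data.Maybe using (Maybe; just; nothing)
  open import Relation.Nullary using (yes; no)
  open import Relation.Binary.PropositionalEquality using (cong) renaming (refl to ≡-refl)
  open import Algebra.Solver.Ring.AlmostCommutativeRing
    using (_-Raw-AlmostCommutative⟶_; fromCommutativeRing)
  open import Algebra.Properties.Ring ring
    using (-0#≈0#; -‿involutive; -‿+-comm; -‿distribˡ-*; -‿distribʳ-*)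
  open import Algebra.Properties.CommutativeSemigroup +-commutativeSemigroup using (interchange)
  open import Algebra.Properties.Monoid.Mult.TCOptimised +-monoid
    using (1+×; ×-homo-+) renaming (_×_ to _×ᵤ_)
  open import Algebra.Properties.Semiring.Mult.TCOptimised semiring using (×1-homo-*)
  open import Relation.Binary.Reasoning.Setoid setoid

  signed : Sign → Carrier → Carrier
  signed Sign.+ x = x
  signed Sign.- x = - x

  ⟦_⟧ : ℤ → Carrier
  ⟦ i ⟧ = signed (sign i) (∣ i ∣ ×ᵤ 1#)

  signed-0# : ∀ s → signed s 0# ≈ 0#
  signed-0# Sign.+ = refl
  signed-0# Sign.- = -0#≈0#

  signed-* : ∀ s t x y → signed (s Sign.* t) (x * y) ≈ signed s x * signed t y
  signed-* Sign.+ Sign.+ x y = refl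
  signed-* Sign.+ Sign.- x y = -‿distribʳ-* x y
  signed-* Sign.- Sign.+ x y = -‿distribˡ-* x y
  signed-* Sign.- Sign.- x y = begin
    x * y         ≈⟨ -‿involutive (x * y) ⟨
    - - (x * y)   ≈⟨ -‿cong (-‿distribʳ-* x y) ⟩
    - (x * - y)   ≈⟨ -‿distribˡ-* x (- y) ⟩
    - x * - y     ∎

  ⟦◃⟧ : ∀ s n → ⟦ s ◃ n ⟧ ≈ signed s (n ×ᵤ 1#)
  ⟦◃⟧ s       zero    = sym (signed-0# s)
  ⟦◃⟧ Sign.+ (suc n) = refl
  ⟦◃⟧ Sign.- (suc n) = refl

  1+x-[1+y]≈x-y : ∀ x y → (1# + x) - (1# + y) ≈ x - y
  1+x-[1+y]≈x-y x y = begin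
    (1# + x) + - (1# + y)     ≈⟨ +-congˡ (-‿+-comm 1# y) ⟨
    (1# + x) + (- 1# + - y)   ≈⟨ interchange 1# x (- 1#) (- y) ⟩
    (1# - 1#) + (x - y)       ≈⟨ +-congʳ (-‿inverseʳ 1#) ⟩
    0# + (x - y)              ≈⟨ +-identityˡ (x - y) ⟩
    x - y                     ∎

  ⟦⊖⟧ : ∀ m n → ⟦ m ⊖ n ⟧ ≈ m ×ᵤ 1# - n ×ᵤ 1#
  ⟦⊖⟧ m       zero    = sym (trans (+-congˡ -0#≈0#) (+-identityʳ _))
  ⟦⊖⟧ zero    (suc n) = sym (+-identityˡ _)
  ⟦⊖⟧ (suc m) (suc n) = begin
    ⟦ suc m ⊖ suc n ⟧                ≡⟨ cong ⟦_⟧ (ℤ.[1+m]⊖[1+n]≡m⊖n m n) ⟩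
    ⟦ m ⊖ n ⟧                        ≈⟨ ⟦⊖⟧ m n ⟩
    m ×ᵤ 1# - n ×ᵤ 1#                ≈⟨ 1+x-[1+y]≈x-y (m ×ᵤ 1#) (n ×ᵤ 1#) ⟨
    (1# + m ×ᵤ 1#) - (1# + n ×ᵤ 1#)  ≈⟨ +-cong (1+× m 1#) (-‿cong (1+× n 1#)) ⟨
    suc m ×ᵤ 1# - suc n ×ᵤ 1#        ∎

  ⟦+⟧ : ∀ i j → ⟦ i ℤ.+ j ⟧ ≈ ⟦ i ⟧ + ⟦ j ⟧
  ⟦+⟧ (+ m)    (+ n)    = ×-homo-+ 1# m n
  ⟦+⟧ (+ m)    -[1+ n ] = ⟦⊖⟧ m (suc n)
  ⟦+⟧ -[1+ m ] (+ n)    = trans (⟦⊖⟧ n (suc m)) (+-comm _ _)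
  ⟦+⟧ -[1+ m ] -[1+ n ] = begin
    - (suc (suc (m ℕ.+ n)) ×ᵤ 1#)      ≡⟨ cong (λ k → - (suc k ×ᵤ 1#)) (ℕ.+-suc m n) ⟨
    - ((suc m ℕ.+ suc n) ×ᵤ 1#)        ≈⟨ -‿cong (×-homo-+ 1# (suc m) (suc n)) ⟩
    - (suc m ×ᵤ 1# + suc n ×ᵤ 1#)      ≈⟨ -‿+-comm _ _ ⟨
    - (suc m ×ᵤ 1#) + - (suc n ×ᵤ 1#)  ∎

  ⟦-⟧ : ∀ i → ⟦ ℤ.- i ⟧ ≈ - ⟦ i ⟧
  ⟦-⟧ (+ zero)  = sym -0#≈0#
  ⟦-⟧ (+ suc n) = refl
  ⟦-⟧ -[1+ n ]  = sym (-‿involutive _)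

  ⟦*⟧ : ∀ i j → ⟦ i ℤ.* j ⟧ ≈ ⟦ i ⟧ * ⟦ j ⟧
  ⟦*⟧ i j = begin
    ⟦ sign i Sign.* sign j ◃ ∣ i ∣ ℕ.* ∣ j ∣ ⟧                ≈⟨ ⟦◃⟧ (sign i Sign.* sign j) (∣ i ∣ ℕ.* ∣ j ∣) ⟩
    signed (sign i Sign.* sign j) ((∣ i ∣ ℕ.* ∣ j ∣) ×ᵤ 1#)   ≈⟨ signed-cong (sign i Sign.* sign j) (×1-homo-* ∣ i ∣ ∣ j ∣) ⟩
    signed (sign i Sign.* sign j) (∣ i ∣ ×ᵤ 1# * ∣ j ∣ ×ᵤ 1#)  ≈⟨ signed-* (sign i) (sign j) _ _ ⟩
    ⟦ i ⟧ * ⟦ j ⟧                                             ∎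
    where
    signed-cong : ∀ s {x y} → x ≈ y → signed s x ≈ signed s y
    signed-cong Sign.+ = λ x≈y → x≈y
    signed-cong Sign.- = -‿cong

  ℤ⟶R : ℤ.+-*-rawRing -Raw-AlmostCommutative⟶ fromCommutativeRing R
  ℤ⟶R = record
    { ⟦_⟧    = ⟦_⟧
    ; +-homo = ⟦+⟧
    ; *-homo = ⟦*⟧
    ; -‿homo = ⟦-⟧
    ; 0-homo = refl
    ; 1-homo = refl
    }

  ⟦⟧-≟ : ∀ i j → Maybe (⟦ i ⟧ ≈ ⟦ j ⟧)
  ⟦⟧-≟ i j with i ℤ.≟ j
  ... | yes ≡-refl = just refl
  ... | no _       = nothing

  open import Algebra.Solver.Ring ℤ.+-*-rawRing (fromCommutativeRing R) ℤ⟶R ⟦⟧-≟ public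
    using (solve; _:=_; _:+_; _:*_; _:-_; :-_; con)


module _ {c ℓ : Level} (F : FiniteField c ℓ) where
  open FiniteField F hiding (zero)
  open Sudoku F
  open IntegerCoefficients commRing using (solve; _:=_; _:+_; _:*_; _:-_; :-_; con)
  open import Algebra.Properties.Ring ring using (-0#≈0#; x∙y⁻¹≈ε⇒x≈y; x≈y⇒x∙y⁻¹≈ε)
  open import Data.Vec.Functional using (Vector; zipWith)
  open import Data.Vec.Functional.Relation.Binary.Equality.Setoid setoid
    using (_≋_; ≋-refl; ≋-sym; ≋-trans; ≋-setoid)
  module ≈-Reasoning = Relation.Binary.Reasoning.Setoid setoid
  module ≋-Reasoning = Relation.Binary.Reasoning.Setoid (≋-setoid 2)

  Vec2 : Set c
  Vec2 = Vector Carrier 2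

  pair : Carrier → Carrier → Vec2
  pair a b zero       = a
  pair a b (suc zero) = b

  pair-η : ∀ u → pair (u zero) (u (suc zero)) ≋ u
  pair-η u zero       = refl
  pair-η u (suc zero) = refl

  0₂ : Vec2
  0₂ _ = 0#

  infixl 6 _+₂_ _-₂_
  _+₂_ _-₂_ : Vec2 → Vec2 → Vec2
  _+₂_ = zipWith _+_
  _-₂_ = zipWith _-_

  +₂-cong : ∀ {u u' v v'} → u ≋ u' → v ≋ v' → u +₂ v ≋ u' +₂ v'
  +₂-cong u≋u' v≋v' i = +-cong (u≋u' i) (v≋v' i)

  infixr 7 _⊛_
  _⊛_ : Mat2 → Vec2 → Vec2
  (A ⊛ u) i = A i zero * u zero + A i (suc zero) * u (suc zero)

  ⊛-cong : ∀ A {u v} → u ≋ v → A ⊛ u ≋ A ⊛ v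
  ⊛-cong A u≋v i = +-cong (*-congˡ (u≋v zero)) (*-congˡ (u≋v (suc zero)))

  ⊛-congˡ : ∀ {A B} u → A ≈M B → A ⊛ u ≋ B ⊛ u
  ⊛-congˡ u A≈B i = +-cong (*-congʳ (A≈B i zero)) (*-congʳ (A≈B i (suc zero)))

  ·-⊛ : ∀ A B u → (A · B) ⊛ u ≋ A ⊛ B ⊛ u
  ·-⊛ A B u i = solve 8 (λ a₀ a₁ b₀₀ b₀₁ b₁₀ b₁₁ u₀ u₁ →
      (a₀ :* b₀₀ :+ a₁ :* b₁₀) :* u₀ :+ (a₀ :* b₀₁ :+ a₁ :* b₁₁) :* u₁
        := a₀ :* (b₀₀ :* u₀ :+ b₀₁ :* u₁) :+ a₁ :* (b₁₀ :* u₀ :+ b₁₁ :* u₁))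
    refl (A i zero) (A i (suc zero)) (B zero zero) (B zero (suc zero))
         (B (suc zero) zero) (B (suc zero) (suc zero)) (u zero) (u (suc zero))

  I₂-⊛ : ∀ u → I₂ ⊛ u ≋ u
  I₂-⊛ u zero       = solve 2 (λ u₀ u₁ → con ℤ.1ℤ :* u₀ :+ con ℤ.0ℤ :* u₁ := u₀) refl (u zero) (u (suc zero))
  I₂-⊛ u (suc zero) = solve 2 (λ u₀ u₁ → con ℤ.0ℤ :* u₀ :+ con ℤ.1ℤ :* u₁ := u₁) refl (u zero) (u (suc zero))

  ⊛-0₂ : ∀ A → A ⊛ 0₂ ≋ 0₂
  ⊛-0₂ A i = solve 2 (λ a₀ a₁ → a₀ :* con ℤ.0ℤ :+ a₁ :* con ℤ.0ℤ := con ℤ.0ℤ) refl (A i zero) (A i (suc zero))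

  module _ {A B : Mat2} (A·B≈I₂ : (A · B) ≈M I₂) (B·A≈I₂ : (B · A) ≈M I₂) where
    open ≋-Reasoning

    ⊛-solve : ∀ {u w} → w ≋ A ⊛ u ⇔ u ≋ B ⊛ w
    ⊛-solve {u} {w} = mk⇔ to from
      where
      to : w ≋ A ⊛ u → u ≋ B ⊛ w
      to w≋Au = begin
        u             ≈⟨ I₂-⊛ u ⟨
        I₂ ⊛ u        ≈⟨ ⊛-congˡ u B·A≈I₂ ⟨
        (B · A) ⊛ u   ≈⟨ ·-⊛ B A u ⟩
        B ⊛ A ⊛ u     ≈⟨ ⊛-cong B w≋Au ⟨
        B ⊛ w         ∎
      from : u ≋ B ⊛ w → w ≋ A ⊛ u
      from u≋Bw = begin
        w             ≈⟨ I₂-⊛ w ⟨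
        I₂ ⊛ w        ≈⟨ ⊛-congˡ w A·B≈I₂ ⟨
        (A · B) ⊛ w   ≈⟨ ·-⊛ A B w ⟩
        A ⊛ B ⊛ w     ≈⟨ ⊛-cong A u≋Bw ⟨
        A ⊛ u         ∎

  adjugate : Mat2 → Mat2
  adjugate A zero       zero       = A (suc zero) (suc zero)
  adjugate A zero       (suc zero) = - A zero (suc zero)
  adjugate A (suc zero) zero       = - A (suc zero) zero
  adjugate A (suc zero) (suc zero) = A zero zero

  infixr 7 _•_
  _•_ : Carrier → Mat2 → Mat2
  (x • A) i j = x * A i j

  ·-scaledAdjugate : ∀ A δ i j → (A · (δ • adjugate A)) i j ≈ (det A * δ) * I₂ i j
  ·-scaledAdjugate A δ zero zero = solve 5 (λ a b c d δ →
    a :* (δ :* d) :+ b :* (δ :* :- c) := (a :* d :- b :* c) :* δ :* con ℤ.1ℤ)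
    refl (A zero zero) (A zero (suc zero)) (A (suc zero) zero) (A (suc zero) (suc zero)) δ
  ·-scaledAdjugate A δ zero (suc zero) = solve 5 (λ a b c d δ →
    a :* (δ :* :- b) :+ b :* (δ :* a) := (a :* d :- b :* c) :* δ :* con ℤ.0ℤ)
    refl (A zero zero) (A zero (suc zero)) (A (suc zero) zero) (A (suc zero) (suc zero)) δ
  ·-scaledAdjugate A δ (suc zero) zero = solve 5 (λ a b c d δ →
    c :* (δ :* d) :+ d :* (δ :* :- c) := (a :* d :- b :* c) :* δ :* con ℤ.0ℤ)
    refl (A zero zero) (A zero (suc zero)) (A (suc zero) zero) (A (suc zero) (suc zero)) δ
  ·-scaledAdjugate A δ (suc zero) (suc zero) = solve 5 (λ a b c d δ →
    c :* (δ :* :- b) :+ d :* (δ :* a) := (a :* d :- b :* c) :* δ :* con ℤ.1ℤ)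
    refl (A zero zero) (A zero (suc zero)) (A (suc zero) zero) (A (suc zero) (suc zero)) δ

  scaledAdjugate-· : ∀ A δ i j → ((δ • adjugate A) · A) i j ≈ (det A * δ) * I₂ i j
  scaledAdjugate-· A δ zero zero = solve 5 (λ a b c d δ →
    δ :* d :* a :+ δ :* :- b :* c := (a :* d :- b :* c) :* δ :* con ℤ.1ℤ)
    refl (A zero zero) (A zero (suc zero)) (A (suc zero) zero) (A (suc zero) (suc zero)) δ
  scaledAdjugate-· A δ zero (suc zero) = solve 5 (λ a b c d δ →
    δ :* d :* b :+ δ :* :- b :* d := (a :* d :- b :* c) :* δ :* con ℤ.0ℤ)
    refl (A zero zero) (A zero (suc zero)) (A (suc zero) zero) (A (suc zero) (suc zero)) δ
  scaledAdjugate-· A δ (suc zero) zero = solve 5 (λ a b c d δ →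
    δ :* :- c :* a :+ δ :* a :* c := (a :* d :- b :* c) :* δ :* con ℤ.0ℤ)
    refl (A zero zero) (A zero (suc zero)) (A (suc zero) zero) (A (suc zero) (suc zero)) δ
  scaledAdjugate-· A δ (suc zero) (suc zero) = solve 5 (λ a b c d δ →
    δ :* :- c :* b :+ δ :* a :* d := (a :* d :- b :* c) :* δ :* con ℤ.1ℤ)
    refl (A zero zero) (A zero (suc zero)) (A (suc zero) zero) (A (suc zero) (suc zero)) δ

  det≉0⇒invertible : ∀ {A} → ¬ det A ≈ 0# → Invertible A
  det≉0⇒invertible {A} detA≉0 =
    let δ , detA*δ≈1 = inverse (det A) detA≉0
        ≈I₂ : ∀ {M} → (∀ i j → M i j ≈ (det A * δ) * I₂ i j) → M ≈M I₂
        ≈I₂ M≈ i j = trans (M≈ i j) (trans (*-congʳ detA*δ≈1) (*-identityˡ (I₂ i j)))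
    in δ • adjugate A , ≈I₂ (·-scaledAdjugate A δ) , ≈I₂ (scaledAdjugate-· A δ)

  -- A singular A kills (- b , a) and (- d , c), which forces its first column to vanish.
  injective⇒det≉0 : ∀ {A} → (∀ u → A ⊛ u ≋ 0₂ → u ≋ 0₂) → ¬ det A ≈ 0#
  injective⇒det≉0 {A} injective detA≈0 = 1≉0 (injective (pair 1# 0#) first-column≈0 zero)
    where
    a = A zero zero
    b = A zero (suc zero)
    c′ = A (suc zero) zero
    d = A (suc zero) (suc zero)
    a≈0 : a ≈ 0#
    a≈0 = injective (pair (- b) a) (λ where
      zero       → solve 2 (λ a b → a :* :- b :+ b :* a := con ℤ.0ℤ) refl a b
      (suc zero) → trans (solve 4 (λ a b c d → c :* :- b :+ d :* a := a :* d :- b :* c) refl a b c′ d) detA≈0)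
      (suc zero)
    c≈0 : c′ ≈ 0#
    c≈0 = injective (pair (- d) c′) (λ where
      zero       → trans (solve 4 (λ a b c d → a :* :- d :+ b :* c := :- (a :* d :- b :* c)) refl a b c′ d)
                         (trans (-‿cong detA≈0) -0#≈0#)
      (suc zero) → solve 2 (λ c d → c :* :- d :+ d :* c := con ℤ.0ℤ) refl c′ d)
      (suc zero)
    first-column≈0 : A ⊛ pair 1# 0# ≋ 0₂
    first-column≈0 zero       = trans (solve 2 (λ a b → a :* con ℤ.1ℤ :+ b :* con ℤ.0ℤ := a) refl a b) a≈0
    first-column≈0 (suc zero) = trans (solve 2 (λ c d → c :* con ℤ.1ℤ :+ d :* con ℤ.0ℤ := c) refl c′ d) c≈0

  pointwise-⇔ : ∀ {i p q} {I : Set i} {P : I → Set p} {Q : I → Set q} →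
                (∀ k → P k ⇔ Q k) → (∀ k → P k) ⇔ (∀ k → Q k)
  pointwise-⇔ P⇔Q = mk⇔ (λ p k → Equivalence.to (P⇔Q k) (p k)) (λ q k → Equivalence.from (P⇔Q k) (q k))

  ⇔-byDifference : ∀ {a b c d} → a - b ≈ c - d → (a ≈ b) ⇔ (c ≈ d)
  ⇔-byDifference {a} {b} {c} {d} a-b≈c-d = mk⇔
    (λ a≈b → x∙y⁻¹≈ε⇒x≈y c d (trans (sym a-b≈c-d) (x≈y⇒x∙y⁻¹≈ε a≈b)))
    (λ c≈d → x∙y⁻¹≈ε⇒x≈y a b (trans a-b≈c-d (x≈y⇒x∙y⁻¹≈ε c≈d)))

  ≋+₂⇔-₂≋ : ∀ {u v w} → u ≋ v +₂ w ⇔ u -₂ w ≋ v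
  ≋+₂⇔-₂≋ {u} {v} {w} = pointwise-⇔ λ i → ⇔-byDifference
    (solve 3 (λ u v w → u :- (v :+ w) := (u :- w) :- v) refl (u i) (v i) (w i))

  top bottom : Vec4 → Vec2
  top z    = pair (z zero) (z (suc zero))
  bottom z = pair (z (suc (suc zero))) (z (suc (suc (suc zero))))

  halves : Vec2 → Vec2 → Vec4
  halves s t = loc (s zero) (s (suc zero)) (t zero) (t (suc zero))

  ≈v-halves : ∀ {z s t} → top z ≋ s → bottom z ≋ t → z ≈v halves s t
  ≈v-halves top≋s bottom≋t zero                   = top≋s zero
  ≈v-halves top≋s bottom≋t (suc zero)             = top≋s (suc zero)
  ≈v-halves top≋s bottom≋t (suc (suc zero))       = bottom≋t zero
  ≈v-halves top≋s bottom≋t (suc (suc (suc zero))) = bottom≋t (suc zero)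

  0v : Vec4
  0v _ = 0#

  ∈⟦I₂⨾⟧⇔ : ∀ C v → ⟦ I₂ ⨾ C ⟧ v ⇔ bottom v ≋ C ⊛ top v
  ∈⟦I₂⨾⟧⇔ C v = mk⇔ to from
    where
    to : ⟦ I₂ ⨾ C ⟧ v → bottom v ≋ C ⊛ top v
    to (a , b , v≈) = λ where
        zero       → trans (v≈ (suc (suc zero))) (⊛-cong C pair≋top zero)
        (suc zero) → trans (v≈ (suc (suc (suc zero)))) (⊛-cong C pair≋top (suc zero))
      where
      pair≋top : pair a b ≋ top v
      pair≋top zero       = sym (trans (v≈ zero) (I₂-⊛ (pair a b) zero))
      pair≋top (suc zero) = sym (trans (v≈ (suc zero)) (I₂-⊛ (pair a b) (suc zero)))
    from : bottom v ≋ C ⊛ top v → ⟦ I₂ ⨾ C ⟧ v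
    from bottom≋ = v zero , v (suc zero) , λ where
      zero                   → sym (I₂-⊛ (top v) zero)
      (suc zero)             → sym (I₂-⊛ (top v) (suc zero))
      (suc (suc zero))       → bottom≋ zero
      (suc (suc (suc zero))) → bottom≋ (suc zero)

  intercept : Mat2 → Vec4 → Vec2
  intercept C x = bottom x -₂ C ⊛ top x

  OnGraph : Mat2 → Vec2 → Vec4 → Set ℓ
  OnGraph C o z = bottom z ≋ C ⊛ top z +₂ o

  hasSymbol⇔onGraph : ∀ C x z → HasSymbol ⟦ I₂ ⨾ C ⟧ x z ⇔ OnGraph C (intercept C x) z
  hasSymbol⇔onGraph C x z = ⇔-trans (∈⟦I₂⨾⟧⇔ C (z -v x)) (pointwise-⇔ λ where
      zero       → coordinate zero (suc (suc zero))
      (suc zero) → coordinate (suc zero) (suc (suc (suc zero))))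
    where
    coordinate : ∀ i k →
      (z k - x k ≈ C i zero * (z zero - x zero) + C i (suc zero) * (z (suc zero) - x (suc zero))) ⇔
      (z k ≈ (C i zero * z zero + C i (suc zero) * z (suc zero)) + (x k - (C i zero * x zero + C i (suc zero) * x (suc zero))))
    coordinate i k = ⇔-byDifference (solve 8 (λ c₀ c₁ z₀ z₁ zₖ x₀ x₁ xₖ →
        (zₖ :- xₖ) :- (c₀ :* (z₀ :- x₀) :+ c₁ :* (z₁ :- x₁))
          := zₖ :- ((c₀ :* z₀ :+ c₁ :* z₁) :+ (xₖ :- (c₀ :* x₀ :+ c₁ :* x₁))))
      refl (C i zero) (C i (suc zero)) (z zero) (z (suc zero)) (z k) (x zero) (x (suc zero)) (x k))

  intercept-0v : ∀ C → intercept C 0v ≋ 0₂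
  intercept-0v C = λ where
      zero       → origin zero
      (suc zero) → origin (suc zero)
    where
    origin : ∀ i → 0# - (C i zero * 0# + C i (suc zero) * 0#) ≈ 0#
    origin i = solve 2 (λ a b → con ℤ.0ℤ :- (a :* con ℤ.0ℤ :+ b :* con ℤ.0ℤ) := con ℤ.0ℤ)
        refl (C i zero) (C i (suc zero))

  exactlyOnePair : ∀ {P : Carrier → Carrier → Set (c ⊔ ℓ)} w →
                   (∀ u v → P u v ⇔ pair u v ≋ w) → ExactlyOnePair P
  exactlyOnePair w P⇔ =
    (w zero , w (suc zero)) ,
    Equivalence.from (P⇔ _ _) (pair-η w) ,
    λ u v Puv → let pair≋w = Equivalence.to (P⇔ u v) Puv in pair≋w zero , pair≋w (suc zero)

  exactlyOnePair-unique : ∀ {P : Carrier → Carrier → Set (c ⊔ ℓ)} → ExactlyOnePair P →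
                          ∀ {u v u' v'} → P u v → P u' v' → u ≈ u' × v ≈ v'
  exactlyOnePair-unique (_ , _ , unique) Puv Pu'v' =
    let u≈ , v≈ = unique _ _ Puv
        u'≈ , v'≈ = unique _ _ Pu'v'
    in trans u≈ (sym u'≈) , trans v≈ (sym v'≈)

  latinRows : ∀ C → LatinRows ⟦ I₂ ⨾ C ⟧
  latinRows C x x1 x2 = exactlyOnePair (C ⊛ pair x1 x2 +₂ intercept C x) λ x3 x4 →
    hasSymbol⇔onGraph C x (loc x1 x2 x3 x4)

  invertible⇒latinCols : ∀ {C} → Invertible C → LatinCols ⟦ I₂ ⨾ C ⟧
  invertible⇒latinCols {C} (B , C·B≈I₂ , B·C≈I₂) x x3 x4 =
    exactlyOnePair (B ⊛ (pair x3 x4 -₂ intercept C x)) λ x1 x2 →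
      ⇔-trans (hasSymbol⇔onGraph C x (loc x1 x2 x3 x4))
              (⇔-trans ≋+₂⇔-₂≋ (⊛-solve {C} {B} C·B≈I₂ B·C≈I₂))

  -- In column (0, 0) the origin's symbol occurs in row u for every u in the kernel of C.
  latinCols⇒injective : ∀ {C} → LatinCols ⟦ I₂ ⨾ C ⟧ → ∀ u → C ⊛ u ≋ 0₂ → u ≋ 0₂
  latinCols⇒injective {C} cols u Cu≋0 = λ where
      zero       → proj₁ u≈0
      (suc zero) → proj₂ u≈0
    where
    inKernel : ∀ v → C ⊛ v ≋ 0₂ → HasSymbol ⟦ I₂ ⨾ C ⟧ 0v (halves v 0₂)
    inKernel v Cv≋0 = Equivalence.from (hasSymbol⇔onGraph C 0v (halves v 0₂)) (λ where
        zero       → on zero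
        (suc zero) → on (suc zero))
      where
      on : ∀ i → 0# ≈ (C ⊛ top (halves v 0₂) +₂ intercept C 0v) i
      on i = sym (trans (+-cong (trans (⊛-cong C (pair-η v) i) (Cv≋0 i)) (intercept-0v C i)) (+-identityʳ 0#))
    u≈0 = exactlyOnePair-unique (cols 0v 0# 0#) (inKernel u Cu≋0) (inKernel 0₂ (⊛-0₂ C))

  latinCols⇔invertible : ∀ {C} → LatinCols ⟦ I₂ ⨾ C ⟧ ⇔ Invertible C
  latinCols⇔invertible {C} = mk⇔
    (λ cols → det≉0⇒invertible {C} (injective⇒det≉0 {C} (latinCols⇒injective {C} cols)))
    (invertible⇒latinCols {C})

  -- x4 is free, so only x3 ≈ C₀₀ x1 + C₀₁ x2 + o must be met, by x2 = C₀₁⁻¹ (x3 − (C₀₀ x1 + o)).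
  C₀₁≉0⇒subsquares : ∀ {C} → ¬ C zero (suc zero) ≈ 0# → Subsquares ⟦ I₂ ⨾ C ⟧
  C₀₁≉0⇒subsquares {C} C₀₁≉0 x x1 x3 =
    x2 , w (suc zero) , Equivalence.from (hasSymbol⇔onGraph C x (loc x1 x2 x3 (w (suc zero)))) (λ where
      zero       → sym first
      (suc zero) → refl)
    where
    open ≈-Reasoning
    a = C zero zero
    b = C zero (suc zero)
    o = intercept C x zero
    b⁻¹ = inverse b C₀₁≉0
    ε = proj₁ b⁻¹
    t = x3 - (a * x1 + o)
    x2 = ε * t
    w = C ⊛ pair x1 x2 +₂ intercept C x
    first : (a * x1 + b * x2) + o ≈ x3
    first = begin
      (a * x1 + b * (ε * t)) + o  ≈⟨ solve 6 (λ a b ε o x1 x3 →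
          (a :* x1 :+ b :* (ε :* (x3 :- (a :* x1 :+ o)))) :+ o
            := x3 :+ (b :* ε :- con ℤ.1ℤ) :* (x3 :- (a :* x1 :+ o))) refl a b ε o x1 x3 ⟩
      x3 + (b * ε - 1#) * t       ≈⟨ +-congˡ (*-congʳ (x≈y⇒x∙y⁻¹≈ε (proj₂ b⁻¹))) ⟩
      x3 + 0# * t                 ≈⟨ solve 2 (λ x3 t → x3 :+ con ℤ.0ℤ :* t := x3) refl x3 t ⟩
      x3                          ∎

  subsquares⇒C₀₁≉0 : ∀ {C} → Subsquares ⟦ I₂ ⨾ C ⟧ → ¬ C zero (suc zero) ≈ 0#
  subsquares⇒C₀₁≉0 {C} squares C₀₁≈0 = 1≉0 (begin
    1#                                        ≈⟨ onGraph zero ⟩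
    (a * 0# + C zero (suc zero) * x2) + o     ≈⟨ +-cong (+-congˡ (*-congʳ C₀₁≈0)) (intercept-0v C zero) ⟩
    (a * 0# + 0# * x2) + 0#                   ≈⟨ solve 2 (λ a x2 →
                                                   (a :* con ℤ.0ℤ :+ con ℤ.0ℤ :* x2) :+ con ℤ.0ℤ := con ℤ.0ℤ)
                                                 refl a x2 ⟩
    0#                                        ∎)
    where
    open ≈-Reasoning
    a = C zero zero
    x2 = proj₁ (squares 0v 0# 1#)
    x4 = proj₁ (proj₂ (squares 0v 0# 1#))
    o = intercept C 0v zero
    onGraph : OnGraph C (intercept C 0v) (loc 0# x2 1# x4)
    onGraph = Equivalence.to (hasSymbol⇔onGraph C 0v (loc 0# x2 1# x4)) (proj₂ (proj₂ (squares 0v 0# 1#)))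

  generatesSudoku⇔ : ∀ C → GeneratesSudoku ⟦ I₂ ⨾ C ⟧ ⇔ (Invertible C × ¬ C zero (suc zero) ≈ 0#)
  generatesSudoku⇔ C = mk⇔
    (λ (_ , cols , squares) → Equivalence.to (latinCols⇔invertible {C}) cols , subsquares⇒C₀₁≉0 {C} squares)
    (λ (invertible , C₀₁≉0) → latinRows C , invertible⇒latinCols {C} invertible , C₀₁≉0⇒subsquares {C} C₀₁≉0)

  graphs-meet⇔ : ∀ C₁ C₂ o₁ o₂ s → C₂ ⊛ s +₂ o₂ ≋ C₁ ⊛ s +₂ o₁ ⇔ o₂ -₂ o₁ ≋ (C₁ − C₂) ⊛ s
  graphs-meet⇔ C₁ C₂ o₁ o₂ s = pointwise-⇔ λ i → ⇔-byDifference (solve 8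
    (λ a₀ a₁ b₀ b₁ s₀ s₁ p q →
      ((b₀ :* s₀ :+ b₁ :* s₁) :+ q) :- ((a₀ :* s₀ :+ a₁ :* s₁) :+ p)
        := (q :- p) :- ((a₀ :- b₀) :* s₀ :+ (a₁ :- b₁) :* s₁))
    refl (C₁ i zero) (C₁ i (suc zero)) (C₂ i zero) (C₂ i (suc zero)) (s zero) (s (suc zero)) (o₁ i) (o₂ i))

  pointOver : Mat2 → Vec2 → Vec2 → Vec4
  pointOver C o s = halves s (C ⊛ s +₂ o)

  pointOver-onGraphs : ∀ C₁ C₂ o₁ o₂ s → o₂ -₂ o₁ ≋ (C₁ − C₂) ⊛ s →
                       OnGraph C₁ o₁ (pointOver C₁ o₁ s) × OnGraph C₂ o₂ (pointOver C₁ o₁ s)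
  pointOver-onGraphs C₁ C₂ o₁ o₂ s meet =
    ≋-trans (pair-η _) (over C₁) ,
    ≋-trans (pair-η _) (≋-trans (≋-sym (Equivalence.from (graphs-meet⇔ C₁ C₂ o₁ o₂ s) meet)) (over C₂))
    where
    over : ∀ C {o} → C ⊛ s +₂ o ≋ C ⊛ top (pointOver C₁ o₁ s) +₂ o
    over C = +₂-cong (⊛-cong C (≋-sym (pair-η s))) ≋-refl

  invertible⇒orthogonal : ∀ C₁ C₂ → Invertible (C₁ − C₂) → Orthogonal ⟦ I₂ ⨾ C₁ ⟧ ⟦ I₂ ⨾ C₂ ⟧
  invertible⇒orthogonal C₁ C₂ (B , D·B≈I₂ , B·D≈I₂) x y =
    pointOver C₁ o₁ s ,
    (symbol₁ (proj₁ onGraphs) , symbol₂ (proj₂ onGraphs)) ,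
    λ z (h₁ , h₂) →
      let on₁ = Equivalence.to (hasSymbol⇔onGraph C₁ x z) h₁
          on₂ = Equivalence.to (hasSymbol⇔onGraph C₂ y z) h₂
          top≋s = solve-D (Equivalence.to (graphs-meet⇔ C₁ C₂ o₁ o₂ (top z)) (≋-trans (≋-sym on₂) on₁))
      in ≈v-halves top≋s (≋-trans on₁ (+₂-cong (⊛-cong C₁ top≋s) ≋-refl))
    where
    o₁ = intercept C₁ x
    o₂ = intercept C₂ y
    s = B ⊛ (o₂ -₂ o₁)
    solve-D : ∀ {u} → o₂ -₂ o₁ ≋ (C₁ − C₂) ⊛ u → u ≋ s
    solve-D = Equivalence.to (⊛-solve {C₁ − C₂} {B} D·B≈I₂ B·D≈I₂)
    onGraphs = pointOver-onGraphs C₁ C₂ o₁ o₂ s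
                 (Equivalence.from (⊛-solve {C₁ − C₂} {B} D·B≈I₂ B·D≈I₂) ≋-refl)
    symbol₁ = Equivalence.from (hasSymbol⇔onGraph C₁ x (pointOver C₁ o₁ s))
    symbol₂ = Equivalence.from (hasSymbol⇔onGraph C₂ y (pointOver C₁ o₁ s))

  -- Over every u in the kernel of C₁ − C₂ lies a location carrying the origin's symbol in both squares.
  orthogonal⇒injective : ∀ C₁ C₂ → Orthogonal ⟦ I₂ ⨾ C₁ ⟧ ⟦ I₂ ⨾ C₂ ⟧ →
                         ∀ u → (C₁ − C₂) ⊛ u ≋ 0₂ → u ≋ 0₂
  orthogonal⇒injective C₁ C₂ orth u Du≋0 = λ where
      zero       → over-u≈over-0 zero
      (suc zero) → over-u≈over-0 (suc zero)
    where
    o₁ = intercept C₁ 0v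
    o₂ = intercept C₂ 0v
    unique = proj₂ (proj₂ (orth 0v 0v))
    o₂-o₁≋0 : o₂ -₂ o₁ ≋ 0₂
    o₂-o₁≋0 i = trans (+-cong (intercept-0v C₂ i) (-‿cong (intercept-0v C₁ i))) (-‿inverseʳ 0#)
    symbols : ∀ v → (C₁ − C₂) ⊛ v ≋ 0₂ →
              HasSymbol ⟦ I₂ ⨾ C₁ ⟧ 0v (pointOver C₁ o₁ v) × HasSymbol ⟦ I₂ ⨾ C₂ ⟧ 0v (pointOver C₁ o₁ v)
    symbols v Dv≋0 =
      let on₁ , on₂ = pointOver-onGraphs C₁ C₂ o₁ o₂ v (≋-trans o₂-o₁≋0 (≋-sym Dv≋0))
      in Equivalence.from (hasSymbol⇔onGraph C₁ 0v _) on₁ , Equivalence.from (hasSymbol⇔onGraph C₂ 0v _) on₂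
    over-u≈over-0 : pointOver C₁ o₁ u ≈v pointOver C₁ o₁ 0₂
    over-u≈over-0 k = trans (unique _ (symbols u Du≋0) k) (sym (unique _ (symbols 0₂ (⊛-0₂ (C₁ − C₂))) k))

  orthogonal⇔det≉0 : ∀ C₁ C₂ → Orthogonal ⟦ I₂ ⨾ C₁ ⟧ ⟦ I₂ ⨾ C₂ ⟧ ⇔ (¬ det (C₁ − C₂) ≈ 0#)
  orthogonal⇔det≉0 C₁ C₂ = mk⇔
    (λ orth → injective⇒det≉0 {C₁ − C₂} (orthogonal⇒injective C₁ C₂ orth))
    (λ det≉0 → invertible⇒orthogonal C₁ C₂ (det≉0⇒invertible {C₁ − C₂} det≉0))

corollary2p4 : ∀ {c ℓ : Level} (F : FiniteField c ℓ) →
    let open FiniteField F hiding (zero)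
        open Sudoku F
    in ¬ (1# + 1# ≈ 0#) → (C₁ C₂ : Mat2) →
       GenerateOrthogonalSudoku ⟦ I₂ ⨾ C₁ ⟧ ⟦ I₂ ⨾ C₂ ⟧ ⇔
       ((Invertible C₁ × ¬ (C₁ zero (suc zero) ≈ 0#)) ×
        (Invertible C₂ × ¬ (C₂ zero (suc zero) ≈ 0#)) ×
        ¬ (det (C₁ − C₂) ≈ 0#))
corollary2p4 F _ C₁ C₂ =
  generatesSudoku⇔ F C₁ ×-⇔ generatesSudoku⇔ F C₂ ×-⇔ orthogonal⇔det≉0 F C₁ C₂
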